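{- The class ${2Eq}_{\mathrm{fin}}$ is $\Sigma_1$-interpretable with parameters in the class ${LEq}_{\mathrm{fin}}$.
   Context: Signatures contain no function symbols. ${2Eq}_{\mathrm{fin}}$ is the class of all finite structures in the signature $\{P^2,Q^2\}$ in which both $P$ and $Q$ are equivalence relations. ${LEq}_{\mathrm{fin}}$ is the class of all finite structures in the signature $\{<^2,\approx^2\}$ in which $<$ is a (strict) linear order and $\approx$ is an equivalence relation. A $\sigma_2$-scheme in $\sigma_1$ is a collection of $\sigma_2$-formulas $\Phi_U(x,\bar y)$ and, for each $n$-ary predicate symbol $R$ of $\sigma_1$, formulas $\Phi_R(x_1,\dots,x_n,\bar y)$ and $\Phi_{\neg R}(x_1,\dots,x_n,\bar y)$, where $\bar y$ is a fixed tuple of variables. For $\mathcal{K}_1$ a class of $\sigma_1$-structures and $\mathcal{K}_2$ a class of $\sigma_2$-structures, $\mathcal{K}_1$ is interpretable with parameters in $\mathcal{K}_2$ if there is a $\sigma_2$-scheme in $\sigma_1$ such that for every $\mathfrak{A}\in\mathcal{K}_1$ there are $\mathfrak{B}\in\mathcal{K}_2$ and a tuple $\bar p$ from $B$ with: (1) $B':=\{b\in B:\mathfrak{B}\models\Phi_U(b,\bar p)\}$ is nonempty; (2) for every $n$-ary predicate symbol $R$ of $\sigma_1$ and all $\bar b\in (B')^n$, $\mathfrak{B}\models\Phi_{\neg R}(\bar b,\bar p)$ iff $\mathfrak{B}\not\models\Phi_R(\bar b,\bar p)$; (3) $\mathfrak{A}$ is isomorphic to the $\sigma_1$-structure $\mathfrak{B}'$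 with universe $B'$ in which $\mathfrak{B}'\models R(\bar b)$ iff $\mathfrak{B}\models\Phi_R(\bar b,\bar p)$. It is $\Sigma_k$-interpretable with parameters if moreover all formulas of the scheme are $\Sigma_k$-formulas (prenex formulas with exactly $k$ alternating quantifier blocks starting with $\exists$ and quantifier-free matrix). -}

module Defs where

open import Data.Nat using (ℕ; zero; suc; _+_)
open import Data.Fin using (Fin)
open import Data.Vec using (Vec; []; _∷_; lookup; map; _++_)
open import Data.Vec.Relation.Unary.All using (All)
open import Data.Bool using (Bool; T)
open import Data.Product using (Σ; ∃; _×_; _,_)
open import Data.Sum using (_⊎_)
open import Data.Empty using (⊥)
open import Data.Unit using (⊤)
open import Relation.Nullary using (¬_)
open import Relation.Binary.PropositionalEquality using (_≡_)
open import Relation.Binary.Structures using (IsEquivalence; IsStrictTotalOrder)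
open import Function.Bundles using (_⇔_)
open import Function.Definitions using (Injective)

record Signature : Set₁ where
  field
    Sym   : Set
    arity : Sym → ℕ
open Signature public

-- First-order formulas (with equality), variables in scoped de Bruijn
-- style: a formula in context n has free variables among Fin n; a
-- quantifier binds variable 0 and shifts the others.

data Formula (σ : Signature) : ℕ → Set where
  rel  : ∀ {n} (R : Sym σ) → Vec (Fin n) (arity σ R) → Formula σ n
  eq   : ∀ {n} → Fin n → Fin n → Formula σ n
  tt   : ∀ {n} → Formula σ n
  ff   : ∀ {n} → Formula σ n
  neg  : ∀ {n} → Formula σ n → Formula σ n
  and  : ∀ {n} → Formula σ n → Formula σ n → Formula σ n
  or   : ∀ {n} → Formula σ n → Formula σ n → Formula σ n
  ex   : ∀ {n} → Formula σ (suc n) → Formula σ n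
  all  : ∀ {n} → Formula σ (suc n) → Formula σ n

data QF {σ : Signature} : ∀ {n} → Formula σ n → Set where
  rel : ∀ {n} R (xs : Vec (Fin n) (arity σ R)) → QF (rel R xs)
  eq  : ∀ {n} (i j : Fin n) → QF (eq i j)
  tt  : ∀ {n} → QF (tt {n = n})
  ff  : ∀ {n} → QF (ff {n = n})
  neg : ∀ {n} {φ : Formula σ n} → QF φ → QF (neg φ)
  and : ∀ {n} {φ ψ : Formula σ n} → QF φ → QF ψ → QF (and φ ψ)
  or  : ∀ {n} {φ ψ : Formula σ n} → QF φ → QF ψ → QF (or φ ψ)

-- Prenex Σ_k / Π_k formulas: exactly k alternating (nonempty) quantifier
-- blocks, Σ_k starting with ∃, Π_k starting with ∀, quantifier-free matrix.
data IsΣ {σ : Signature} : ℕ → ∀ {n} → Formula σ n → Set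
data IsΠ {σ : Signature} : ℕ → ∀ {n} → Formula σ n → Set

data IsΣ {σ} where
  qf    : ∀ {n} {φ : Formula σ n} → QF φ → IsΣ 0 φ
  exΣ   : ∀ {k n} {φ : Formula σ (suc n)} → IsΣ (suc k) φ → IsΣ (suc k) (ex φ)
  exΠ   : ∀ {k n} {φ : Formula σ (suc n)} → IsΠ k φ → IsΣ (suc k) (ex φ)

data IsΠ {σ} where
  qf    : ∀ {n} {φ : Formula σ n} → QF φ → IsΠ 0 φ
  allΠ  : ∀ {k n} {φ : Formula σ (suc n)} → IsΠ (suc k) φ → IsΠ (suc k) (all φ)
  allΣ  : ∀ {k n} {φ : Formula σ (suc n)} → IsΣ k φ → IsΠ (suc k) (all φ)

record FinStructure (σ : Signature) : Set where
  field
    size   : ℕ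
    interp : (R : Sym σ) → Vec (Fin (suc size)) (arity σ R) → Bool

Carrier : ∀ {σ} → FinStructure σ → Set
Carrier 𝔄 = Fin (suc (FinStructure.size 𝔄))

holds : ∀ {σ} (𝔄 : FinStructure σ) (R : Sym σ) → Vec (Carrier 𝔄) (arity σ R) → Set
holds 𝔄 R as = T (FinStructure.interp 𝔄 R as)

Sat : ∀ {σ n} (𝔄 : FinStructure σ) → Formula σ n → Vec (Carrier 𝔄) n → Set
Sat 𝔄 (rel R xs) ρ = holds 𝔄 R (map (lookup ρ) xs)
Sat 𝔄 (eq i j)   ρ = lookup ρ i ≡ lookup ρ j
Sat 𝔄 tt         ρ = ⊤
Sat 𝔄 ff         ρ = ⊥
Sat 𝔄 (neg φ)    ρ = ¬ Sat 𝔄 φ ρ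
Sat 𝔄 (and φ ψ)  ρ = Sat 𝔄 φ ρ × Sat 𝔄 ψ ρ
Sat 𝔄 (or φ ψ)   ρ = Sat 𝔄 φ ρ ⊎ Sat 𝔄 ψ ρ
Sat 𝔄 (ex φ)     ρ = ∃ λ a → Sat 𝔄 φ (a ∷ ρ)
Sat 𝔄 (all φ)    ρ = ∀ a → Sat 𝔄 φ (a ∷ ρ)

Class : Signature → Set₁
Class σ = FinStructure σ → Set

-- A σ₂-scheme in σ₁; the parameter tuple ȳ has length `params`.
-- Variable order in context: x₁ … xₙ first, then ȳ.
record Scheme (σ₁ σ₂ : Signature) : Set where
  field
    params : ℕ
    ΦU     : Formula σ₂ (suc params)
    ΦR     : (R : Sym σ₁) → Formula σ₂ (arity σ₁ R + params)
    Φ¬R    : (R : Sym σ₁) → Formula σ₂ (arity σ₁ R + params)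
open Scheme public

SchemeIsΣ : ∀ {σ₁ σ₂} → ℕ → Scheme σ₁ σ₂ → Set
SchemeIsΣ {σ₁} k S =
  IsΣ k (ΦU S) × ((R : Sym σ₁) → IsΣ k (ΦR S R) × IsΣ k (Φ¬R S R))

-- The isomorphism 𝔄 ≅ 𝔅' is given as a
-- map f : A → B which is a bijection onto B' = {b | 𝔅 ⊨ ΦU(b, p̄)} and
-- preserves and reflects every relation.
Interprets : ∀ {σ₁ σ₂} (S : Scheme σ₁ σ₂) (𝔄 : FinStructure σ₁)
             (𝔅 : FinStructure σ₂) (p : Vec (Carrier 𝔅) (params S)) → Set
Interprets {σ₁} S 𝔄 𝔅 p =
  (∃ λ b → InU b)
  × ((R : Sym σ₁) (bs : Vec (Carrier 𝔅) (arity σ₁ R)) → All InU bs →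
       (Sat 𝔅 (Φ¬R S R) (bs ++ p) ⇔ (¬ Sat 𝔅 (ΦR S R) (bs ++ p))))
  × (Σ (Carrier 𝔄 → Carrier 𝔅) λ f →
        ((a : Carrier 𝔄) → InU (f a))
      × Injective _≡_ _≡_ f
      × ((b : Carrier 𝔅) → InU b → ∃ λ a → f a ≡ b)
      × ((R : Sym σ₁) (as : Vec (Carrier 𝔄) (arity σ₁ R)) →
           (holds 𝔄 R as ⇔ Sat 𝔅 (ΦR S R) (map f as ++ p))))
  where
  InU : Carrier 𝔅 → Set
  InU b = Sat 𝔅 (ΦU S) (b ∷ p)

ΣInterpretableWithParams : ∀ {σ₁ σ₂} → ℕ → Class σ₁ → Class σ₂ → Set
ΣInterpretableWithParams {σ₁} {σ₂} k 𝒦₁ 𝒦₂ =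
  Σ (Scheme σ₁ σ₂) λ S → SchemeIsΣ k S ×
    ((𝔄 : FinStructure σ₁) → 𝒦₁ 𝔄 →
      Σ (FinStructure σ₂) λ 𝔅 → 𝒦₂ 𝔅 ×
        Σ (Vec (Carrier 𝔅) (params S)) λ p → Interprets S 𝔄 𝔅 p)

data EqSym : Set where
  P Q : EqSym

σ2Eq : Signature
σ2Eq = record { Sym = EqSym ; arity = λ _ → 2 }

data LEqSym : Set where
  lt approx : LEqSym

σLEq : Signature
σLEq = record { Sym = LEqSym ; arity = λ _ → 2 }

rel2 : ∀ {S : Set} (𝔄 : FinStructure (record { Sym = S ; arity = λ _ → 2 })) →
       S → Carrier 𝔄 → Carrier 𝔄 → Set
rel2 𝔄 R x y = T (FinStructure.interp 𝔄 R (x ∷ y ∷ []))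

TwoEqFin : Class σ2Eq
TwoEqFin 𝔄 = IsEquivalence (rel2 𝔄 P) × IsEquivalence (rel2 𝔄 Q)

LEqFin : Class σLEq
LEqFin 𝔅 = IsStrictTotalOrder _≡_ (rel2 𝔅 lt) × IsEquivalence (rel2 𝔅 approx)

-- Represent each element i of a 2Eq-structure by a block ℓᵢ < qᵢ < pᵢ < rᵢ of a linear
-- order, all blocks followed by tags t₀ < t₁ < ⋯, and let ≈ identify pᵢ with pⱼ iff P i j,
-- qᵢ with qⱼ iff Q i j, and ℓᵢ, rᵢ, tᵢ with each other only.  With parameter t₀, the
-- quantifier-free condition  l < x < a < r < t₀, l ≈ r, l ≈ z, ¬ z < t₀  forces z to be a
-- tag, hence l and r to be the brackets of a single block, hence x and a its q- and p-point.
-- So ∃ l x r z of it defines the p-points, P is ≈ between p-points, and Q is ≈ between the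
-- q-points found as witnesses.  The witnesses being unique, negating only the matrix
-- defines the complements, so every formula of the scheme is Σ₁.

module Submission where

open import Level using (0ℓ)
open import Data.Nat using (ℕ; suc; _+_; _*_; z≤n; s≤s)
open import Data.Fin using (Fin; zero; suc; #_)
import Data.Fin as F
import Data.Fin.Properties as FP
open import Data.Vec using (Vec; []; _∷_; _++_; map; lookup; tabulate)
open import Data.Vec.Properties using (lookup∘tabulate; tabulate-cong)
import Data.Vec.Properties as VecP
open import Data.Vec.Relation.Unary.All using (All; []; _∷_)
open import Data.Bool using (Bool; T)
open import Data.Bool.Properties using (T-≡; ⇔→≡) renaming (_≟_ to _≟ᵇ_)
open import Data.Product using (∃; _×_; _,_; proj₁; proj₂; map₂)
open import Data.Product.Function.NonDependent.Propositional using (_×-⇔_)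
open import Data.Product.Relation.Binary.Lex.Strict using (×-Lex; ×-isStrictTotalOrder)
open import Data.Product.Relation.Binary.Pointwise.NonDependent
  using (≡×≡⇒≡) renaming (Pointwise to ×-Pointwise)
open import Data.Sum using (_⊎_; inj₁; inj₂)
open import Data.Sum.Properties using (≡-dec; inj₁-injective; inj₂-injective)
open import Data.Sum.Function.Propositional using (_⊎-↔_)
open import Data.Sum.Relation.Binary.LeftOrder using (_⊎-<_; ₁∼₂; ₁∼₁; ₂∼₂; ⊎-<-isStrictTotalOrder)
open import Data.Sum.Relation.Binary.Pointwise as ⊎ using () renaming (Pointwise to ⊎-Pointwise)
open import Data.Empty using (⊥-elim)
open import Function using (_∘_; flip; id; _↔_; _⇔_; mk⇔; Inverse; Injection; Equivalence)
open import Function.Construct.Composition using (_⇔-∘_)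
open import Function.Construct.Symmetry using (⇔-sym)
open import Function.Properties.Inverse using (↔-trans; ↔-refl; ↔-sym; ↔⇒↣)
open import Function.Related.TypeIsomorphisms using (¬-cong-⇔)
open import Function.Definitions using (Injective)
open import Relation.Nullary using (¬_)
open import Relation.Nullary.Decidable using (⌊_⌋; toWitness; fromWitness)
open import Relation.Binary.Core using (Rel; _⇒_)
open import Relation.Binary.Definitions using (DecidableEquality)
open import Relation.Binary.Structures using (IsEquivalence; IsStrictTotalOrder)
open import Relation.Binary.Morphism.Structures using (IsOrderMonomorphism)
open import Relation.Binary.PropositionalEquality
  using (_≡_; refl; sym; trans; cong; subst; subst₂; isEquivalence; module ≡-Reasoning)
import Relation.Binary.Construct.On as On
import Relation.Binary.Construct.Subst.Equality as Subst
import Relation.Binary.Morphism.OrderMonomorphism as OrderMonomorphism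

open import Defs

inhabited-×⇔ : {W A : Set} → W → (W × A) ⇔ A
inhabited-×⇔ w = mk⇔ proj₂ (w ,_)

inhabited-×-¬⇔¬-× : {W A : Set} → W → (W × ¬ A) ⇔ (¬ (W × A))
inhabited-×-¬⇔¬-× w = mk⇔ (λ (_ , ¬a) (_ , a) → ¬a a) (λ ¬wa → w , λ a → ¬wa (w , a))

T-⇔⇒≡ : ∀ {a b} → T a ⇔ T b → a ≡ b
T-⇔⇒≡ a⇔b = ⇔→≡ (T-≡ ⇔-∘ (a⇔b ⇔-∘ ⇔-sym T-≡))

row : ∀ {n} → (Fin n → Fin n → Bool) → Fin n → Vec Bool n
row r i = tabulate (r i)

row-≡⇔ : ∀ {n} {r : Fin n → Fin n → Bool} → IsEquivalence (λ i j → T (r i j)) →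
         ∀ i j → row r i ≡ row r j ⇔ T (r i j)
row-≡⇔ {r = r} isEq i j = mk⇔ to from
  where
  module R = IsEquivalence isEq
  open ≡-Reasoning
  to : row r i ≡ row r j → T (r i j)
  to rowi≡rowj = subst T (sym rij≡rjj) (R.refl {j})
    where
    rij≡rjj : r i j ≡ r j j
    rij≡rjj = begin
      r i j              ≡⟨ lookup∘tabulate (r i) j ⟨
      lookup (row r i) j ≡⟨ cong (flip lookup j) rowi≡rowj ⟩
      lookup (row r j) j ≡⟨ lookup∘tabulate (r j) j ⟩
      r j j              ∎
  from : T (r i j) → row r i ≡ row r j
  from rij = tabulate-cong λ k →
    T-⇔⇒≡ (mk⇔ (R.trans {j} {i} {k} (R.sym {i} {j} rij)) (R.trans {i} {j} {k} rij))

module Induced {m : ℕ} {K Key : Set} {_≈_ _<_ : Rel K 0ℓ}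
  (decode : Fin (suc m) → K) (decode-injective : Injective _≡_ _≡_ decode)
  (<-isStrictTotalOrder : IsStrictTotalOrder _≈_ _<_) (≈⇒≡ : _≈_ ⇒ _≡_)
  (key : K → Key) (_≟_ : DecidableEquality Key) where

  open IsStrictTotalOrder <-isStrictTotalOrder using (_<?_; module Eq)

  interp : LEqSym → Vec (Fin (suc m)) 2 → Bool
  interp lt     (x ∷ y ∷ []) = ⌊ decode x <? decode y ⌋
  interp approx (x ∷ y ∷ []) = ⌊ key (decode x) ≟ key (decode y) ⌋

  induced : FinStructure σLEq
  induced = record { size = m ; interp = interp }

  _≺_ _∼_ : Fin (suc m) → Fin (suc m) → Set
  _≺_ = rel2 induced lt
  _∼_ = rel2 induced approx

  ≺⇔< : ∀ {x y} → x ≺ y ⇔ decode x < decode y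
  ≺⇔< {x} {y} = mk⇔ toWitness (fromWitness {a? = decode x <? decode y})

  ∼⇔≡ : ∀ {x y} → x ∼ y ⇔ key (decode x) ≡ key (decode y)
  ∼⇔≡ {x} {y} = mk⇔ toWitness (fromWitness {a? = key (decode x) ≟ key (decode y)})

  induced-LEqFin : LEqFin induced
  induced-LEqFin =
    OrderMonomorphism.isStrictTotalOrder decode-isOrderMonomorphism <-isStrictTotalOrder ,
    Subst.isEquivalence (Equivalence.from ∼⇔≡ , Equivalence.to ∼⇔≡)
                        (On.isEquivalence (key ∘ decode) isEquivalence)
    where
    decode-isOrderMonomorphism : IsOrderMonomorphism _≡_ _≈_ _≺_ _<_ decode
    decode-isOrderMonomorphism = record
      { isOrderHomomorphism = record
        { cong = Eq.reflexive ∘ cong decode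
        ; mono = Equivalence.to ≺⇔<
        }
      ; injective = decode-injective ∘ ≈⇒≡
      ; cancel    = Equivalence.from ≺⇔<
      }

infix 4 _≺ᶠ_ _∼ᶠ_

_≺ᶠ_ _∼ᶠ_ : ∀ {k} → Fin k → Fin k → Formula σLEq k
i ≺ᶠ j = rel lt (i ∷ j ∷ [])
i ∼ᶠ j = rel approx (i ∷ j ∷ [])

blockFormula : ∀ {k} (l x a r z t : Fin k) → Formula σLEq k
blockFormula l x a r z t =
  and (l ≺ᶠ x) (and (x ≺ᶠ a) (and (a ≺ᶠ r) (and (r ≺ᶠ t)
    (and (l ∼ᶠ r) (and (l ∼ᶠ z) (neg (z ≺ᶠ t)))))))

blockFormula-QF : ∀ {k} (l x a r z t : Fin k) → QF (blockFormula l x a r z t)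
blockFormula-QF _ _ _ _ _ _ =
  and (rel _ _) (and (rel _ _) (and (rel _ _) (and (rel _ _)
    (and (rel _ _) (and (rel _ _) (neg (rel _ _)))))))

-- Witnesses are bound innermost first: the context of the matrix is z r x l a t in
-- universeFormula, and z′ r′ y l′ z r x l b b′ t in pairFormula.

universeFormula : Formula σLEq 2
universeFormula = ex (ex (ex (ex (blockFormula (# 3) (# 2) (# 4) (# 1) (# 0) (# 5)))))

pairFormula : Formula σLEq 11 → Formula σLEq 3
pairFormula μ = ex (ex (ex (ex (ex (ex (ex (ex
  (and (blockFormula (# 7) (# 6) (# 8) (# 5) (# 4) (# 10))
  (and (blockFormula (# 3) (# 2) (# 9) (# 1) (# 0) (# 10)) μ)))))))))

pairFormula-Σ₁ : ∀ {μ} → QF μ → IsΣ 1 (pairFormula μ)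
pairFormula-Σ₁ μ-QF = exΣ (exΣ (exΣ (exΣ (exΣ (exΣ (exΣ (exΠ (qf
  (and (blockFormula-QF _ _ _ _ _ _) (and (blockFormula-QF _ _ _ _ _ _) μ-QF))))))))))

sameQSlot : Formula σLEq 11
sameQSlot = # 6 ∼ᶠ # 2

-- The quantifier in the P-formulas is vacuous; Σ₁ demands a nonempty ∃-block.
relationFormula complementFormula : EqSym → Formula σLEq 3
relationFormula P   = ex (# 1 ∼ᶠ # 2)
relationFormula Q   = pairFormula sameQSlot
complementFormula P = ex (neg (# 1 ∼ᶠ # 2))
complementFormula Q = pairFormula (neg sameQSlot)

scheme : Scheme σ2Eq σLEq
scheme = record
  { params = 1
  ; ΦU     = universeFormula
  ; ΦR     = relationFormula
  ; Φ¬R    = complementFormula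
  }

scheme-Σ₁ : SchemeIsΣ 1 scheme
scheme-Σ₁ = exΣ (exΣ (exΣ (exΠ (qf (blockFormula-QF _ _ _ _ _ _))))) , λ
  { P → exΠ (qf (rel _ _)) , exΠ (qf (neg (rel _ _)))
  ; Q → pairFormula-Σ₁ (rel _ _) , pairFormula-Σ₁ (neg (rel _ _))
  }

module Blocks (n : ℕ) {C : Set} (_≟C_ : DecidableEquality C) (qClass pClass : Fin (suc n) → C) where

  Slot : Set
  Slot = Fin 4

  pattern opening = zero
  pattern qSlot   = suc zero
  pattern pSlot   = suc (suc zero)
  pattern closing = suc (suc (suc zero))

  _<ₛ_ : Slot → Slot → Set
  _<ₛ_ = F._<_

  inner-slots : ∀ {s s′} → opening <ₛ s → s <ₛ s′ → s′ <ₛ closing → s ≡ qSlot × s′ ≡ pSlot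
  inner-slots {qSlot}   {pSlot}   _ _ _ = refl , refl
  inner-slots {qSlot}   {opening} _ () _
  inner-slots {qSlot}   {qSlot}   _ (s≤s ()) _
  inner-slots {qSlot}   {closing} _ _ (s≤s (s≤s (s≤s ())))
  inner-slots {pSlot}   {opening} _ () _
  inner-slots {pSlot}   {qSlot}   _ (s≤s ()) _
  inner-slots {pSlot}   {pSlot}   _ (s≤s (s≤s ())) _
  inner-slots {pSlot}   {closing} _ _ (s≤s (s≤s (s≤s ())))
  inner-slots {closing} {opening} _ () _
  inner-slots {closing} {qSlot}   _ (s≤s ()) _
  inner-slots {closing} {pSlot}   _ (s≤s (s≤s ())) _
  inner-slots {closing} {closing} _ (s≤s (s≤s (s≤s ()))) _

  Point : Set
  Point = (Fin (suc n) × Slot) ⊎ Fin (suc n)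

  pattern block i s = inj₁ (i , s)
  pattern tag i     = inj₂ i

  infix 4 _<_ _≈_

  _<_ _≈_ : Rel Point 0ℓ
  _<_ = ×-Lex _≡_ F._<_ _<ₛ_ ⊎-< F._<_
  _≈_ = ⊎-Pointwise (×-Pointwise _≡_ _≡_) _≡_

  <-isStrictTotalOrder : IsStrictTotalOrder _≈_ _<_
  <-isStrictTotalOrder = ⊎-<-isStrictTotalOrder
    (×-isStrictTotalOrder FP.<-isStrictTotalOrder FP.<-isStrictTotalOrder) FP.<-isStrictTotalOrder

  open IsStrictTotalOrder <-isStrictTotalOrder using (irrefl; module Eq) renaming (trans to <-trans)

  ≈⇒≡ : _≈_ ⇒ _≡_
  ≈⇒≡ (⊎.inj₁ i,s≈j,t) = cong inj₁ (≡×≡⇒≡ i,s≈j,t)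
  ≈⇒≡ (⊎.inj₂ refl)    = refl

  <-irrefl : ∀ {p} → ¬ p < p
  <-irrefl = irrefl Eq.refl

  Key : Set
  Key = Fin (suc n) ⊎ C ⊎ C

  key : Point → Key
  key (block i opening) = inj₁ i
  key (block i qSlot)   = inj₂ (inj₁ (qClass i))
  key (block i pSlot)   = inj₂ (inj₂ (pClass i))
  key (block i closing) = inj₁ i
  key (tag i)           = inj₁ i

  opaque
    code : Fin (suc n * 4 + suc n) ↔ Point
    code = ↔-trans FP.+↔⊎ (FP.*↔× ⊎-↔ ↔-refl)

  open Inverse code using (strictlyInverseˡ; inverseʳ) renaming (to to decode)
  open Inverse code public using () renaming (from to ⌜_⌝)

  open Induced decode (Injection.injective (↔⇒↣ code)) <-isStrictTotalOrder ≈⇒≡ key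
               (≡-dec FP._≟_ (≡-dec _≟C_ _≟C_)) public

  IsBlock : (l x a r z : Point) → Set
  IsBlock l x a r z =
    l < x × x < a × a < r × r < tag zero × key l ≡ key r × key l ≡ key z × ¬ z < tag zero

  BlockOf : ∀ {X : Set} → (Point → X) → Fin (suc n) → (l x a r z : X) → Set
  BlockOf e i l x a r z =
    l ≡ e (block i opening) × x ≡ e (block i qSlot) × a ≡ e (block i pSlot) ×
    r ≡ e (block i closing) × z ≡ e (tag i)

  block-isBlock : ∀ i →
    IsBlock (block i opening) (block i qSlot) (block i pSlot) (block i closing) (tag i)
  block-isBlock i =
    ₁∼₁ (inj₂ (refl , s≤s z≤n)) , ₁∼₁ (inj₂ (refl , s≤s (s≤s z≤n))) ,
    ₁∼₁ (inj₂ (refl , s≤s (s≤s (s≤s z≤n)))) , ₁∼₂ , refl , refl , λ { (₂∼₂ ()) }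

  ¬<tag₀⇒tag : ∀ {p} → ¬ p < tag zero → ∃ λ i → p ≡ tag i
  ¬<tag₀⇒tag {block _ _} p≮ = ⊥-elim (p≮ ₁∼₂)
  ¬<tag₀⇒tag {tag i}     _  = i , refl

  bracket-key⇒ : ∀ {p i} → key p ≡ inj₁ i → p < tag zero → p ≡ block i opening ⊎ p ≡ block i closing
  bracket-key⇒ {block _ opening} refl _ = inj₁ refl
  bracket-key⇒ {block _ closing} refl _ = inj₂ refl
  bracket-key⇒ {block _ qSlot}   ()
  bracket-key⇒ {block _ pSlot}   ()
  bracket-key⇒ {tag _}           _    (₂∼₂ ())

  bracket-pair : ∀ {i l r} → l ≡ block i opening ⊎ l ≡ block i closing →
                 r ≡ block i opening ⊎ r ≡ block i closing → l < r →
                 l ≡ block i opening × r ≡ block i closing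
  bracket-pair (inj₁ refl) (inj₂ refl) _                 = refl , refl
  bracket-pair (inj₁ refl) (inj₁ refl) l<r               = ⊥-elim (<-irrefl l<r)
  bracket-pair (inj₂ refl) (inj₂ refl) l<r               = ⊥-elim (<-irrefl l<r)
  bracket-pair (inj₂ refl) (inj₁ refl) (₁∼₁ (inj₁ i<i))  = ⊥-elim (FP.<-irrefl refl i<i)
  bracket-pair (inj₂ refl) (inj₁ refl) (₁∼₁ (inj₂ (_ , ())))

  inside-block : ∀ {i s p s′} → block i s < p → p < block i s′ →
           ∃ λ t → p ≡ block i t × s <ₛ t × t <ₛ s′
  inside-block (₁∼₁ (inj₁ i<j))          (₁∼₁ (inj₁ j<i))         = ⊥-elim (FP.<-asym i<j j<i)
  inside-block (₁∼₁ (inj₁ i<i))          (₁∼₁ (inj₂ (refl , _)))  = ⊥-elim (FP.<-irrefl refl i<i)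
  inside-block (₁∼₁ (inj₂ (refl , _)))   (₁∼₁ (inj₁ i<i))         = ⊥-elim (FP.<-irrefl refl i<i)
  inside-block (₁∼₁ (inj₂ (refl , s<t))) (₁∼₁ (inj₂ (_ , t<s′))) = _ , refl , s<t , t<s′

  isBlock⇒ : ∀ {l x a r z} → IsBlock l x a r z → ∃ λ i → BlockOf id i l x a r z
  isBlock⇒ (l<x , x<a , a<r , r<t , l∼r , l∼z , z≮t)
    with l<r ← <-trans l<x (<-trans x<a a<r)
    with i , refl  ← ¬<tag₀⇒tag z≮t
    with refl , refl ← bracket-pair (bracket-key⇒ l∼z (<-trans l<r r<t))
                                    (bracket-key⇒ (trans (sym l∼r) l∼z) r<t) l<r
    with _ , refl , opening<s , _ ← inside-block l<x (<-trans x<a a<r)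
    with _ , refl , s<s′ , s′<closing ← inside-block x<a a<r
    with refl , refl ← inner-slots opening<s s<s′ s′<closing
    = i , refl , refl , refl , refl , refl

  isBlock⇔ : ∀ {l x a r z} → IsBlock l x a r z ⇔ ∃ λ i → BlockOf id i l x a r z
  isBlock⇔ = mk⇔ isBlock⇒ λ { (i , refl , refl , refl , refl , refl) → block-isBlock i }

  ≡⌜⌝⇔decode≡ : ∀ {b p} → b ≡ ⌜ p ⌝ ⇔ decode b ≡ p
  ≡⌜⌝⇔decode≡ {p = p} =
    mk⇔ (λ b≡ → trans (cong decode b≡) (strictlyInverseˡ p)) (λ e → sym (inverseʳ (sym e)))

  ⌜⌝-injective : ∀ {p q} → ⌜ p ⌝ ≡ ⌜ q ⌝ → p ≡ q
  ⌜⌝-injective = Injection.injective (↔⇒↣ (↔-sym code))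

  t₀ : Carrier induced
  t₀ = ⌜ tag zero ⌝

  SatBlock : (l x a r z t : Carrier induced) → Set
  SatBlock l x a r z t = l ≺ x × x ≺ a × a ≺ r × r ≺ t × l ∼ r × l ∼ z × ¬ z ≺ t

  satBlock⇔ : ∀ l x a r z → SatBlock l x a r z t₀ ⇔ ∃ λ i → BlockOf ⌜_⌝ i l x a r z
  satBlock⇔ l x a r z =
    mk⇔ (map₂ (Equivalence.from BlockOf-⌜⌝⇔)) (map₂ (Equivalence.to BlockOf-⌜⌝⇔))
    ⇔-∘ (isBlock⇔ ⇔-∘ (≺⇔< {l} {x} ×-⇔ ≺⇔< {x} {a} ×-⇔ ≺⇔< {a} {r} ×-⇔ ≺t₀⇔ {r} ×-⇔
                       ∼⇔≡ {l} {r} ×-⇔ ∼⇔≡ {l} {z} ×-⇔ ¬-cong-⇔ (≺t₀⇔ {z})))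
    where
    ≺t₀⇔ : ∀ {y} → y ≺ t₀ ⇔ decode y < tag zero
    ≺t₀⇔ {y} = subst (λ q → y ≺ t₀ ⇔ decode y < q) (strictlyInverseˡ (tag zero)) (≺⇔< {y} {t₀})
    BlockOf-⌜⌝⇔ : ∀ {i} → BlockOf ⌜_⌝ i l x a r z ⇔
                          BlockOf id i (decode l) (decode x) (decode a) (decode r) (decode z)
    BlockOf-⌜⌝⇔ = ≡⌜⌝⇔decode≡ ×-⇔ ≡⌜⌝⇔decode≡ ×-⇔ ≡⌜⌝⇔decode≡ ×-⇔ ≡⌜⌝⇔decode≡ ×-⇔ ≡⌜⌝⇔decode≡

  block-satBlock : ∀ i → SatBlock ⌜ block i opening ⌝ ⌜ block i qSlot ⌝ ⌜ block i pSlot ⌝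
                                 ⌜ block i closing ⌝ ⌜ tag i ⌝ t₀
  block-satBlock i = Equivalence.from (satBlock⇔ _ _ _ _ _) (i , refl , refl , refl , refl , refl)

  InU : Carrier induced → Set
  InU b = Sat induced universeFormula (b ∷ t₀ ∷ [])

  inU⇔ : ∀ b → InU b ⇔ ∃ λ i → b ≡ ⌜ block i pSlot ⌝
  inU⇔ b = mk⇔ to from
    where
    to : InU b → ∃ λ i → b ≡ ⌜ block i pSlot ⌝
    to (l , x , r , z , β) with i , _ , _ , b≡ , _ ← Equivalence.to (satBlock⇔ l x b r z) β = i , b≡
    from : (∃ λ i → b ≡ ⌜ block i pSlot ⌝) → InU b
    from (i , refl) =
      ⌜ block i opening ⌝ , ⌜ block i qSlot ⌝ , ⌜ block i closing ⌝ , ⌜ tag i ⌝ , block-satBlock i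

  pairWitnesses : Fin (suc n) → Fin (suc n) → Vec (Carrier induced) 11
  pairWitnesses i j =
    ⌜ tag j ⌝ ∷ ⌜ block j closing ⌝ ∷ ⌜ block j qSlot ⌝ ∷ ⌜ block j opening ⌝ ∷
    ⌜ tag i ⌝ ∷ ⌜ block i closing ⌝ ∷ ⌜ block i qSlot ⌝ ∷ ⌜ block i opening ⌝ ∷
    ⌜ block i pSlot ⌝ ∷ ⌜ block j pSlot ⌝ ∷ t₀ ∷ []

  pairFormula⇔ : ∀ μ i j →
    Sat induced (pairFormula μ) (⌜ block i pSlot ⌝ ∷ ⌜ block j pSlot ⌝ ∷ t₀ ∷ []) ⇔
    Sat induced μ (pairWitnesses i j)
  pairFormula⇔ μ i j = mk⇔ to from
    where
    to : Sat induced (pairFormula μ) (⌜ block i pSlot ⌝ ∷ ⌜ block j pSlot ⌝ ∷ t₀ ∷ []) →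
         Sat induced μ (pairWitnesses i j)
    to (l , x , r , z , l′ , y , r′ , z′ , β , β′ , μ-holds)
      with i′ , refl , refl , a≡ , refl , refl ← Equivalence.to (satBlock⇔ l  x ⌜ block i pSlot ⌝ r  z)  β
      with j′ , refl , refl , b≡ , refl , refl ← Equivalence.to (satBlock⇔ l′ y ⌜ block j pSlot ⌝ r′ z′) β′
      with refl ← ⌜⌝-injective {block i pSlot} {block i′ pSlot} a≡
      with refl ← ⌜⌝-injective {block j pSlot} {block j′ pSlot} b≡
      = μ-holds
    from : Sat induced μ (pairWitnesses i j) →
           Sat induced (pairFormula μ) (⌜ block i pSlot ⌝ ∷ ⌜ block j pSlot ⌝ ∷ t₀ ∷ [])
    from μ-holds =
      ⌜ block i opening ⌝ , ⌜ block i qSlot ⌝ , ⌜ block i closing ⌝ , ⌜ tag i ⌝ ,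
      ⌜ block j opening ⌝ , ⌜ block j qSlot ⌝ , ⌜ block j closing ⌝ , ⌜ tag j ⌝ ,
      block-satBlock i , block-satBlock j , μ-holds

  pairFormula-neg⇔ : ∀ μ {b b′} → InU b → InU b′ →
    Sat induced (pairFormula (neg μ)) (b ∷ b′ ∷ t₀ ∷ []) ⇔
    (¬ Sat induced (pairFormula μ) (b ∷ b′ ∷ t₀ ∷ []))
  pairFormula-neg⇔ μ {b} {b′} u u′
    with i , refl ← Equivalence.to (inU⇔ b) u
    with j , refl ← Equivalence.to (inU⇔ b′) u′
    = ⇔-sym (¬-cong-⇔ (pairFormula⇔ μ i j)) ⇔-∘ pairFormula⇔ (neg μ) i j

  ⌜⌝-∼⇔ : ∀ {p q} → ⌜ p ⌝ ∼ ⌜ q ⌝ ⇔ key p ≡ key q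
  ⌜⌝-∼⇔ {p} {q} = subst₂ (λ p′ q′ → ⌜ p ⌝ ∼ ⌜ q ⌝ ⇔ key p′ ≡ key q′)
                         (strictlyInverseˡ p) (strictlyInverseˡ q) (∼⇔≡ {⌜ p ⌝} {⌜ q ⌝})

  qSlot-∼⇔ : ∀ {i j} → ⌜ block i qSlot ⌝ ∼ ⌜ block j qSlot ⌝ ⇔ qClass i ≡ qClass j
  qSlot-∼⇔ {i} {j} =
    mk⇔ (inj₁-injective ∘ inj₂-injective) (cong (inj₂ ∘ inj₁))
    ⇔-∘ ⌜⌝-∼⇔ {block i qSlot} {block j qSlot}

  pSlot-∼⇔ : ∀ {i j} → ⌜ block i pSlot ⌝ ∼ ⌜ block j pSlot ⌝ ⇔ pClass i ≡ pClass j
  pSlot-∼⇔ {i} {j} =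
    mk⇔ (inj₂-injective ∘ inj₂-injective) (cong (inj₂ ∘ inj₂))
    ⇔-∘ ⌜⌝-∼⇔ {block i pSlot} {block j pSlot}

module Interpretation (𝔄 : FinStructure σ2Eq) (𝔄-2Eq : TwoEqFin 𝔄) where

  open FinStructure 𝔄 using (size; interp)

  classOf : EqSym → Fin (suc size) → Vec Bool (suc size)
  classOf R = row (λ i j → interp R (i ∷ j ∷ []))

  classOf-≡⇔ : ∀ R → IsEquivalence (rel2 𝔄 R) → ∀ i j → classOf R i ≡ classOf R j ⇔ rel2 𝔄 R i j
  classOf-≡⇔ R = row-≡⇔ {r = λ i j → interp R (i ∷ j ∷ [])}

  open Blocks size (VecP.≡-dec _≟ᵇ_) (classOf Q) (classOf P) public

  embed : Fin (suc size) → Carrier induced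
  embed i = ⌜ block i pSlot ⌝

  embed-injective : Injective _≡_ _≡_ embed
  embed-injective {i} {j} e with refl ← ⌜⌝-injective {block i pSlot} {block j pSlot} e = refl

  complementFormula⇔ : (R : EqSym) (bs : Vec (Carrier induced) 2) → All InU bs →
    Sat induced (complementFormula R) (bs ++ t₀ ∷ []) ⇔
    (¬ Sat induced (relationFormula R) (bs ++ t₀ ∷ []))
  complementFormula⇔ P (b ∷ _ ∷ []) _ = inhabited-×-¬⇔¬-× b
  complementFormula⇔ Q (b ∷ b′ ∷ []) (u ∷ u′ ∷ []) = pairFormula-neg⇔ sameQSlot u u′

  relationFormula⇔ : (R : EqSym) (as : Vec (Fin (suc size)) 2) →
    holds 𝔄 R as ⇔ Sat induced (relationFormula R) (map embed as ++ t₀ ∷ [])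
  relationFormula⇔ P (i ∷ j ∷ []) =
    ⇔-sym (classOf-≡⇔ P (proj₁ 𝔄-2Eq) i j ⇔-∘ (pSlot-∼⇔ ⇔-∘ inhabited-×⇔ t₀))
  relationFormula⇔ Q (i ∷ j ∷ []) =
    ⇔-sym (classOf-≡⇔ Q (proj₂ 𝔄-2Eq) i j ⇔-∘ (qSlot-∼⇔ ⇔-∘ pairFormula⇔ sameQSlot i j))

  interprets : Interprets scheme 𝔄 induced (t₀ ∷ [])
  interprets =
    (embed zero , Equivalence.from (inU⇔ (embed zero)) (zero , refl)) ,
    complementFormula⇔ ,
    embed ,
    (λ i → Equivalence.from (inU⇔ (embed i)) (i , refl)) ,
    embed-injective ,
    (λ b u → let i , b≡ = Equivalence.to (inU⇔ b) u in i , sym b≡) ,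
    relationFormula⇔

lemma3 : ΣInterpretableWithParams 1 TwoEqFin LEqFin
lemma3 = scheme , scheme-Σ₁ , λ 𝔄 𝔄-2Eq →
  let open Interpretation 𝔄 𝔄-2Eq in induced , induced-LEqFin , t₀ ∷ [] , interprets
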